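{- Let $P=P_1\ast P_2$ be a nontrivial gluing of iposets. Then: $P$ is left Winkowski iff $P_1$ is left Winkowski; $P$ is right Winkowski iff $P_2$ is right Winkowski; $P$ is Winkowski iff $P_1$ is left Winkowski and $P_2$ is right Winkowski.
   Context: A poset is a finite set with an irreflexive transitive relation $<$; $P^{\min}$, $P^{\max}$ are its minimal and maximal elements. $[n]=\{1,\dots,n\}$, $[0]=\emptyset$. An iposet $(s,P,t):n\to m$ is a poset $P$ with injective maps $s:[n]\to P$, $t:[m]\to P$, $s([n])\subseteq P^{\min}$, $t([m])\subseteq P^{\max}$. It is left Winkowski if $s([n])=P^{\min}$, right Winkowski if $t([m])=P^{\max}$, and Winkowski if both. For $(s_1,P_1,t_1):n_1\to m_1$ and $(s_2,P_2,t_2):m_1\to m_2$, the gluing $P_1\ast P_2:n_1\to m_2$ has carrier the quotient of the disjoint union $P_1\sqcup P_2$ identifying $(t_1(k),1)$ with $(s_2(k),2)$ for $k\in[m_1]$, order $(p,i)<(q,j)$ iff ($i=j$ and $p<_iq$) or ($i<j$, $p\notin t_1([m_1])$, $q\notin s_2([m_1])$), source map induced by $s_1$ and target map induced by $t_2$. The gluing is trivial if $P=P_1$ or $P=P_2$ as posets, and nontrivial otherwise. -}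

module Defs where

open import Level using (0ℓ)
open import Data.Nat using (ℕ)
open import Data.Fin using (Fin)
open import Data.Sum using (_⊎_; inj₁; inj₂)
open import Data.Product using (Σ; ∃; ∃-syntax; _×_; _,_)
open import Data.Empty using (⊥)
open import Relation.Nullary using (¬_)
open import Relation.Binary.PropositionalEquality using (_≡_)
open import Relation.Binary.Core using (Rel)
open import Relation.Binary.Structures using (IsStrictPartialOrder)
open import Function.Definitions using (Injective)
open import Function.Bundles using (_⇔_)

-- Generic "iposet-shaped" data: a carrier with an equality (so that quotients
-- can be represented as setoids), a strict order, and source/target maps.

record IposetData : Set₁ where
  field
    Carrier : Set
    _≈_     : Rel Carrier 0ℓ
    _<_     : Rel Carrier 0ℓ
    n m     : ℕ
    src     : Fin n → Carrier
    tgt     : Fin m → Carrier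

module _ (D : IposetData) where
  open IposetData D

  IsMin : Carrier → Set
  IsMin x = ∀ y → ¬ (y < x)

  IsMax : Carrier → Set
  IsMax x = ∀ y → ¬ (x < y)

  LeftWinkowski : Set
  LeftWinkowski = ∀ x → (IsMin x ⇔ (∃[ i ] src i ≈ x))

  RightWinkowski : Set
  RightWinkowski = ∀ x → (IsMax x ⇔ (∃[ i ] tgt i ≈ x))

  Winkowski : Set
  Winkowski = LeftWinkowski × RightWinkowski

record Iposet (n m : ℕ) : Set₁ where
  field
    card  : ℕ
    _<_   : Rel (Fin card) 0ℓ
    isSPO : IsStrictPartialOrder _≡_ _<_
    s     : Fin n → Fin card
    t     : Fin m → Fin card
    s-inj : Injective _≡_ _≡_ s
    t-inj : Injective _≡_ _≡_ t
    s-min : ∀ i y → ¬ (y < s i)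
    t-max : ∀ i y → ¬ (t i < y)

toData : ∀ {n m} → Iposet n m → IposetData
toData {n} {m} P = record
  { Carrier = Fin card ; _≈_ = _≡_ ; _<_ = _<_
  ; n = n ; m = m ; src = s ; tgt = t }
  where open Iposet P

-- Gluing P₁ ∗ P₂ : n₁ → m₂ of P₁ : n₁ → m₁ and P₂ : m₁ → m₂.
-- Carrier: the quotient of Fin card₁ ⊎ Fin card₂ by identifying
-- inj₁ (t₁ k) with inj₂ (s₂ k), represented as a setoid.

module Glue {n₁ m₁ m₂ : ℕ} (P₁ : Iposet n₁ m₁) (P₂ : Iposet m₁ m₂) where
  private
    module P₁ = Iposet P₁
    module P₂ = Iposet P₂

  U : Set
  U = Fin P₁.card ⊎ Fin P₂.card

  -- the identification (already an equivalence relation, since t₁, s₂ are injective)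
  data _~_ : U → U → Set where
    ~-refl  : ∀ {x} → x ~ x
    glue    : ∀ k → inj₁ (P₁.t k) ~ inj₂ (P₂.s k)
    glue-sym : ∀ k → inj₂ (P₂.s k) ~ inj₁ (P₁.t k)

  Raw : U → U → Set
  Raw (inj₁ p) (inj₁ q) = P₁._<_ p q
  Raw (inj₂ p) (inj₂ q) = P₂._<_ p q
  Raw (inj₁ p) (inj₂ q) = (¬ (∃[ k ] P₁.t k ≡ p)) × (¬ (∃[ k ] P₂.s k ≡ q))
  Raw (inj₂ p) (inj₁ q) = ⊥

  _<ᴳ_ : U → U → Set
  x <ᴳ y = ∃[ x' ] ∃[ y' ] (x ~ x' × y ~ y' × Raw x' y')

  glued : IposetData
  glued = record
    { Carrier = U ; _≈_ = _~_ ; _<_ = _<ᴳ_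
    ; n = n₁ ; m = m₂
    ; src = λ i → inj₁ (P₁.s i)
    ; tgt = λ i → inj₂ (P₂.t i) }

  -- "P = Pᵢ as posets": the canonical map Pᵢ → P is an order isomorphism
  -- (surjective up to the quotient, and order preserving and reflecting)
  EqualsP₁ : Set
  EqualsP₁ = (∀ x → ∃[ p ] inj₁ p ~ x)
           × (∀ p q → (P₁._<_ p q ⇔ (inj₁ p <ᴳ inj₁ q)))

  EqualsP₂ : Set
  EqualsP₂ = (∀ x → ∃[ p ] inj₂ p ~ x)
           × (∀ p q → (P₂._<_ p q ⇔ (inj₂ p <ᴳ inj₂ q)))

  Trivial : Set
  Trivial = EqualsP₁ ⊎ EqualsP₂

  Nontrivial : Set
  Nontrivial = ¬ Trivial

-- An element of P₁ is minimal in P₁ ∗ P₂ iff it is minimal in P₁, and an interface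
-- element s₂ k of P₂ is minimal in the gluing iff its partner t₁ k is minimal in P₁.
-- Since all sources of the gluing come from P₁, the two left Winkowski conditions
-- therefore agree, except possibly at an element q of P₂ outside the interface.
-- But if such a q were minimal, every element of P₁ off the interface would lie
-- below it, so t₁ would be onto and the gluing would be trivial (P = P₂).
-- The right-hand statement is dual.

module Submission where

open import Defs
open import Data.Nat using (ℕ)
open import Data.Fin.Properties using (any?; _≟_)
open import Data.Sum using (inj₁; inj₂)
open import Data.Product using (_×_; _,_; ∃-syntax)
open import Data.Product.Function.NonDependent.Propositional using (_×-⇔_)
import Data.Product.Function.Dependent.Propositional as Σ
open import Data.Empty using (⊥-elim)
open import Relation.Nullary using (¬_; Dec; yes; no)
open import Relation.Binary.PropositionalEquality using (_≡_; refl; cong)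
open import Function.Bundles using (_⇔_; mk⇔)
open import Function.Related.Propositional using (module EquationalReasoning)
import Function.Properties.Equivalence as ⇔

module GluingWinkowski {n₁ m₁ m₂ : ℕ} (P₁ : Iposet n₁ m₁) (P₂ : Iposet m₁ m₂) where
  private
    module P₁ = Iposet P₁
    module P₂ = Iposet P₂
  open Glue P₁ P₂

  t₁-image? : ∀ p → Dec (∃[ k ] P₁.t k ≡ p)
  t₁-image? p = any? (λ k → P₁.t k ≟ p)

  s₂-image? : ∀ q → Dec (∃[ k ] P₂.s k ≡ q)
  s₂-image? q = any? (λ k → P₂.s k ≟ q)

  inj₁~inj₁⇔≡ : ∀ {a b} → inj₁ a ~ inj₁ b ⇔ a ≡ b
  inj₁~inj₁⇔≡ = mk⇔ (λ { ~-refl → refl }) (λ { refl → ~-refl })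

  inj₂~inj₂⇔≡ : ∀ {a b} → inj₂ a ~ inj₂ b ⇔ a ≡ b
  inj₂~inj₂⇔≡ = mk⇔ (λ { ~-refl → refl }) (λ { refl → ~-refl })

  inj₁~inj₂⇒glued : ∀ {a b} → inj₁ a ~ inj₂ b → ∃[ k ] P₁.t k ≡ a × P₂.s k ≡ b
  inj₁~inj₂⇒glued (glue k) = k , refl , refl

  inj₂~inj₁⇒glued : ∀ {a b} → inj₂ b ~ inj₁ a → ∃[ k ] P₁.t k ≡ a × P₂.s k ≡ b
  inj₂~inj₁⇒glued (glue-sym k) = k , refl , refl

  inj₁~inj₂-s₂⇔≡t₁ : ∀ {a} k → inj₁ a ~ inj₂ (P₂.s k) ⇔ a ≡ P₁.t k
  inj₁~inj₂-s₂⇔≡t₁ k = mk⇔ to λ { refl → glue k }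
    where
    to : ∀ {a} → inj₁ a ~ inj₂ (P₂.s k) → a ≡ P₁.t k
    to e with inj₁~inj₂⇒glued e
    ... | k′ , refl , s₂k′≡s₂k = cong P₁.t (P₂.s-inj s₂k′≡s₂k)

  inj₂~inj₁-t₁⇔≡s₂ : ∀ {b} k → inj₂ b ~ inj₁ (P₁.t k) ⇔ b ≡ P₂.s k
  inj₂~inj₁-t₁⇔≡s₂ k = mk⇔ to λ { refl → glue-sym k }
    where
    to : ∀ {b} → inj₂ b ~ inj₁ (P₁.t k) → b ≡ P₂.s k
    to e with inj₂~inj₁⇒glued e
    ... | k′ , t₁k′≡t₁k , refl = cong P₂.s (P₁.t-inj t₁k′≡t₁k)

  ¬Raw-into-s₂ : ∀ k x → ¬ Raw x (inj₂ (P₂.s k))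
  ¬Raw-into-s₂ k (inj₁ a) (_ , s₂-free) = s₂-free (k , refl)
  ¬Raw-into-s₂ k (inj₂ b) b<s₂k         = P₂.s-min k b b<s₂k

  ¬Raw-out-of-t₁ : ∀ k y → ¬ Raw (inj₁ (P₁.t k)) y
  ¬Raw-out-of-t₁ k (inj₁ a) t₁k<a         = P₁.t-max k a t₁k<a
  ¬Raw-out-of-t₁ k (inj₂ b) (t₁-free , _) = t₁-free (k , refl)

  isMin-inj₁⇔ : ∀ p → IsMin glued (inj₁ p) ⇔ IsMin (toData P₁) p
  isMin-inj₁⇔ p = mk⇔ to from
    where
    to : IsMin glued (inj₁ p) → IsMin (toData P₁) p
    to min a a<p = min (inj₁ a) (inj₁ a , inj₁ p , ~-refl , ~-refl , a<p)
    from : IsMin (toData P₁) p → IsMin glued (inj₁ p)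
    from min _ (inj₁ a , _ , _ , ~-refl , a<p) = min a a<p
    from min _ (x      , _ , _ , glue k , r)   = ¬Raw-into-s₂ k x r

  isMin-inj₂-s₂⇔ : ∀ k → IsMin glued (inj₂ (P₂.s k)) ⇔ IsMin (toData P₁) (P₁.t k)
  isMin-inj₂-s₂⇔ k = mk⇔ to from
    where
    to : IsMin glued (inj₂ (P₂.s k)) → IsMin (toData P₁) (P₁.t k)
    to min a a<t₁k = min (inj₁ a) (inj₁ a , inj₁ (P₁.t k) , ~-refl , glue-sym k , a<t₁k)
    from : IsMin (toData P₁) (P₁.t k) → IsMin glued (inj₂ (P₂.s k))
    from min _ (x      , inj₂ _ , _ , ~-refl , r)  = ¬Raw-into-s₂ k x r
    from min _ (inj₂ _ , inj₁ _ , _ , _      , ())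
    from min _ (inj₁ a , inj₁ c , _ , e      , a<c) with inj₂~inj₁⇒glued e
    ... | k′ , refl , s₂k′≡s₂k rewrite P₂.s-inj s₂k′≡s₂k = min a a<c

  isMax-inj₂⇔ : ∀ q → IsMax glued (inj₂ q) ⇔ IsMax (toData P₂) q
  isMax-inj₂⇔ q = mk⇔ to from
    where
    to : IsMax glued (inj₂ q) → IsMax (toData P₂) q
    to max b q<b = max (inj₂ b) (inj₂ q , inj₂ b , ~-refl , ~-refl , q<b)
    from : IsMax (toData P₂) q → IsMax glued (inj₂ q)
    from max _ (_ , inj₂ b , ~-refl     , _ , q<b) = max b q<b
    from max _ (_ , inj₁ _ , ~-refl     , _ , ())
    from max _ (_ , y      , glue-sym k , _ , r)   = ¬Raw-out-of-t₁ k y r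

  isMax-inj₁-t₁⇔ : ∀ k → IsMax glued (inj₁ (P₁.t k)) ⇔ IsMax (toData P₂) (P₂.s k)
  isMax-inj₁-t₁⇔ k = mk⇔ to from
    where
    to : IsMax glued (inj₁ (P₁.t k)) → IsMax (toData P₂) (P₂.s k)
    to max b s₂k<b = max (inj₂ b) (inj₂ (P₂.s k) , inj₂ b , glue k , ~-refl , s₂k<b)
    from : IsMax (toData P₂) (P₂.s k) → IsMax glued (inj₁ (P₁.t k))
    from max _ (inj₁ _ , y      , ~-refl , _ , r)   = ¬Raw-out-of-t₁ k y r
    from max _ (inj₂ _ , inj₁ _ , _      , _ , ())
    from max _ (inj₂ c , inj₂ b , e      , _ , c<b) with inj₁~inj₂⇒glued e
    ... | k′ , t₁k′≡t₁k , refl rewrite P₁.t-inj t₁k′≡t₁k = max b c<b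

  <ᴳ⇒<₁ : ∀ {a b} → inj₁ a <ᴳ inj₁ b → a P₁.< b
  <ᴳ⇒<₁ (_ , _      , ~-refl , ~-refl , a<b) = a<b
  <ᴳ⇒<₁ (_ , inj₁ _ , glue k , ~-refl , ())
  <ᴳ⇒<₁ (x , _      , _      , glue k , r)   = ⊥-elim (¬Raw-into-s₂ k x r)

  <ᴳ⇒<₂ : ∀ {a b} → inj₂ a <ᴳ inj₂ b → a P₂.< b
  <ᴳ⇒<₂ (_ , _      , ~-refl     , ~-refl     , a<b) = a<b
  <ᴳ⇒<₂ (_ , inj₁ _ , ~-refl     , glue-sym k , ())
  <ᴳ⇒<₂ (_ , y      , glue-sym k , _          , r)   = ⊥-elim (¬Raw-out-of-t₁ k y r)

  s₂-surjective⇒EqualsP₁ : (∀ q → ∃[ k ] P₂.s k ≡ q) → EqualsP₁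
  s₂-surjective⇒EqualsP₁ s₂-surjective =
    onto , λ a b → mk⇔ (λ a<b → inj₁ a , inj₁ b , ~-refl , ~-refl , a<b) <ᴳ⇒<₁
    where
    onto : ∀ x → ∃[ p ] inj₁ p ~ x
    onto (inj₁ p) = p , ~-refl
    onto (inj₂ q) with s₂-surjective q
    ... | k , refl = P₁.t k , glue k

  t₁-surjective⇒EqualsP₂ : (∀ p → ∃[ k ] P₁.t k ≡ p) → EqualsP₂
  t₁-surjective⇒EqualsP₂ t₁-surjective =
    onto , λ a b → mk⇔ (λ a<b → inj₂ a , inj₂ b , ~-refl , ~-refl , a<b) <ᴳ⇒<₂
    where
    onto : ∀ x → ∃[ q ] inj₂ q ~ x
    onto (inj₂ q) = q , ~-refl
    onto (inj₁ p) with t₁-surjective p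
    ... | k , refl = P₂.s k , glue-sym k

  maximal-inj₁⇒s₂-surjective : ∀ {p} → ¬ (∃[ k ] P₁.t k ≡ p) → IsMax glued (inj₁ p)
    → ∀ q → ∃[ k ] P₂.s k ≡ q
  maximal-inj₁⇒s₂-surjective {p} p∉t₁ max q with s₂-image? q
  ... | yes q∈s₂ = q∈s₂
  ... | no  q∉s₂ = ⊥-elim (max (inj₂ q) (inj₁ p , inj₂ q , ~-refl , ~-refl , p∉t₁ , q∉s₂))

  minimal-inj₂⇒t₁-surjective : ∀ {q} → ¬ (∃[ k ] P₂.s k ≡ q) → IsMin glued (inj₂ q)
    → ∀ p → ∃[ k ] P₁.t k ≡ p
  minimal-inj₂⇒t₁-surjective {q} q∉s₂ min p with t₁-image? p
  ... | yes p∈t₁ = p∈t₁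
  ... | no  p∉t₁ = ⊥-elim (min (inj₁ p) (inj₁ p , inj₂ q , ~-refl , ~-refl , p∉t₁ , q∉s₂))

  open EquationalReasoning

  LeftWinkowski-glued⇔ : Nontrivial → LeftWinkowski glued ⇔ LeftWinkowski (toData P₁)
  LeftWinkowski-glued⇔ nontrivial = mk⇔ restrict extend
    where
    restrict : LeftWinkowski glued → LeftWinkowski (toData P₁)
    restrict w p = begin
      IsMin (toData P₁) p              ∼⟨ ⇔.sym (isMin-inj₁⇔ p) ⟩
      IsMin glued (inj₁ p)             ∼⟨ w (inj₁ p) ⟩
      (∃[ i ] inj₁ (P₁.s i) ~ inj₁ p)  ∼⟨ Σ.congˡ inj₁~inj₁⇔≡ ⟩
      (∃[ i ] P₁.s i ≡ p)              ∎
    extend : LeftWinkowski (toData P₁) → LeftWinkowski glued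
    extend w (inj₁ p) = begin
      IsMin glued (inj₁ p)             ∼⟨ isMin-inj₁⇔ p ⟩
      IsMin (toData P₁) p              ∼⟨ w p ⟩
      (∃[ i ] P₁.s i ≡ p)              ∼⟨ Σ.congˡ (⇔.sym inj₁~inj₁⇔≡) ⟩
      (∃[ i ] inj₁ (P₁.s i) ~ inj₁ p)  ∎
    extend w (inj₂ q) with s₂-image? q
    ... | yes (k , refl) = begin
      IsMin glued (inj₂ (P₂.s k))             ∼⟨ isMin-inj₂-s₂⇔ k ⟩
      IsMin (toData P₁) (P₁.t k)              ∼⟨ w (P₁.t k) ⟩
      (∃[ i ] P₁.s i ≡ P₁.t k)                ∼⟨ Σ.congˡ (⇔.sym (inj₁~inj₂-s₂⇔≡t₁ k)) ⟩
      (∃[ i ] inj₁ (P₁.s i) ~ inj₂ (P₂.s k))  ∎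
    ... | no q∉s₂ = mk⇔
      (λ min → ⊥-elim (nontrivial (inj₂ (t₁-surjective⇒EqualsP₂ (minimal-inj₂⇒t₁-surjective q∉s₂ min)))))
      (λ { (_ , e) → let (k , _ , s₂k≡q) = inj₁~inj₂⇒glued e in ⊥-elim (q∉s₂ (k , s₂k≡q)) })

  RightWinkowski-glued⇔ : Nontrivial → RightWinkowski glued ⇔ RightWinkowski (toData P₂)
  RightWinkowski-glued⇔ nontrivial = mk⇔ restrict extend
    where
    restrict : RightWinkowski glued → RightWinkowski (toData P₂)
    restrict w q = begin
      IsMax (toData P₂) q              ∼⟨ ⇔.sym (isMax-inj₂⇔ q) ⟩
      IsMax glued (inj₂ q)             ∼⟨ w (inj₂ q) ⟩
      (∃[ i ] inj₂ (P₂.t i) ~ inj₂ q)  ∼⟨ Σ.congˡ inj₂~inj₂⇔≡ ⟩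
      (∃[ i ] P₂.t i ≡ q)              ∎
    extend : RightWinkowski (toData P₂) → RightWinkowski glued
    extend w (inj₂ q) = begin
      IsMax glued (inj₂ q)             ∼⟨ isMax-inj₂⇔ q ⟩
      IsMax (toData P₂) q              ∼⟨ w q ⟩
      (∃[ i ] P₂.t i ≡ q)              ∼⟨ Σ.congˡ (⇔.sym inj₂~inj₂⇔≡) ⟩
      (∃[ i ] inj₂ (P₂.t i) ~ inj₂ q)  ∎
    extend w (inj₁ p) with t₁-image? p
    ... | yes (k , refl) = begin
      IsMax glued (inj₁ (P₁.t k))             ∼⟨ isMax-inj₁-t₁⇔ k ⟩
      IsMax (toData P₂) (P₂.s k)              ∼⟨ w (P₂.s k) ⟩
      (∃[ i ] P₂.t i ≡ P₂.s k)                ∼⟨ Σ.congˡ (⇔.sym (inj₂~inj₁-t₁⇔≡s₂ k)) ⟩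
      (∃[ i ] inj₂ (P₂.t i) ~ inj₁ (P₁.t k))  ∎
    ... | no p∉t₁ = mk⇔
      (λ max → ⊥-elim (nontrivial (inj₁ (s₂-surjective⇒EqualsP₁ (maximal-inj₁⇒s₂-surjective p∉t₁ max)))))
      (λ { (_ , e) → let (k , t₁k≡p , _) = inj₂~inj₁⇒glued e in ⊥-elim (p∉t₁ (k , t₁k≡p)) })

open GluingWinkowski

lemma5 : ∀ {n₁ m₁ m₂ : ℕ} (P₁ : Iposet n₁ m₁) (P₂ : Iposet m₁ m₂)
    → Glue.Nontrivial P₁ P₂
    → (LeftWinkowski (Glue.glued P₁ P₂) ⇔ LeftWinkowski (toData P₁))
    × (RightWinkowski (Glue.glued P₁ P₂) ⇔ RightWinkowski (toData P₂))
    × (Winkowski (Glue.glued P₁ P₂) ⇔ (LeftWinkowski (toData P₁) × RightWinkowski (toData P₂)))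
lemma5 P₁ P₂ nontrivial = left , right , (left ×-⇔ right)
  where
  left : LeftWinkowski (Glue.glued P₁ P₂) ⇔ LeftWinkowski (toData P₁)
  left = LeftWinkowski-glued⇔ P₁ P₂ nontrivial
  right : RightWinkowski (Glue.glued P₁ P₂) ⇔ RightWinkowski (toData P₂)
  right = RightWinkowski-glued⇔ P₁ P₂ nontrivial
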